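{- Let $\mathcal{N}$ be a sorting network. The contact graphs of all pseudoline arrangements supported by $\mathcal{N}$ have the same connected components (as undirected graphs on $[n]$).
   Context: A network $\mathcal{N}$ with $n$ levels and $m$ commutators consists of $n$ horizontal lines (levels), labeled $1,\dots,n$ from bottom to top, together with $m$ vertical segments (commutators), each joining two consecutive levels, such that no two commutators share an endpoint. A pseudoline is an abscissa-monotone path in $\mathcal{N}$. A contact between two pseudolines is a commutator whose two endpoints lie one on each pseudoline; a crossing between two pseudolines is a commutator traversed by both. A pseudoline arrangement supported by $\mathcal{N}$ is a set of $n$ pseudolines on $\mathcal{N}$ such that any two of them have exactly one crossing, possibly some contacts, and no other intersection; its $i$-th pseudoline is the one starting at level $i$ on the left. $\mathcal{N}$ is sorting if it supports at least one pseudoline arrangement. The contact graph $\Lambda^\#$ of a pseudoline arrangement $\Lambda$ is the directed multigraph on vertex set $[n]$ (vertex $i$ standing for the $i$-th pseudoline) with one arc for each contact of $\Lambda$, oriented from the pseudoline passing above the contact to the pseudoline passing below it. -}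

module Defs where

open import Data.Nat using (ℕ; suc)
open import Data.Fin using (Fin; suc; inject₁; _≟_)
open import Data.Bool using (Bool; true; false; _∧_; _∨_; not; if_then_else_)
open import Data.List using (List; []; _∷_; length; filter; map)
open import Data.Product using (_×_; _,_)
open import Data.Sum using (_⊎_)
open import Relation.Nullary using (¬_)
open import Relation.Nullary.Decidable using (⌊_⌋)
open import Relation.Binary.PropositionalEquality using (_≡_; _≢_)
open import Relation.Binary.Construct.Closure.ReflexiveTransitive using (Star)
open import Data.List.Membership.Propositional using (_∈_)

-- Levels are 0-indexed: a network with (suc p) levels has levels Fin (suc p)
-- (level 0 = bottom).  A commutator is given by k : Fin p and joins the
-- consecutive levels  inject₁ k  (lower) and  suc k  (upper).
-- A network is the left-to-right list of its commutators.
Network : ℕ → Set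
Network p = List (Fin p)

-- Which pseudoline currently occupies each level (level ↦ pseudoline).
State : ℕ → Set
State p = Fin (suc p) → Fin (suc p)

initial : ∀ {p} → State p
initial l = l

swapAt : ∀ {p} → Fin p → Fin (suc p) → Fin (suc p)
swapAt k l =
  if ⌊ l ≟ inject₁ k ⌋ then suc k
  else (if ⌊ l ≟ suc k ⌋ then inject₁ k else l)

-- A candidate arrangement: for each commutator (in order), true = crossing,
-- false = contact.  (Every commutator of a network supporting n pseudolines
-- on n levels is either a crossing or a contact.)
Choice : Set
Choice = List Bool

step : ∀ {p} → State p → Fin p → Bool → State p
step σ k false = σ
step σ k true  = λ l → σ (swapAt k l)

-- One event per commutator: (is-crossing , pseudoline above , pseudoline below)
Event : ℕ → Set
Event p = Bool × Fin (suc p) × Fin (suc p)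

events : ∀ {p} → State p → Network p → Choice → List (Event p)
events σ (k ∷ N) (b ∷ Λ) = (b , σ (suc k) , σ (inject₁ k)) ∷ events (step σ k b) N Λ
events σ _ _ = []

_==_ : ∀ {p} → Fin p → Fin p → Bool
a == b = ⌊ a ≟ b ⌋

isCrossingOf : ∀ {p} → Fin (suc p) → Fin (suc p) → Event p → Bool
isCrossingOf i j (b , u , l) = b ∧ ((u == i ∧ l == j) ∨ (u == j ∧ l == i))

crossings : ∀ {p} → Network p → Choice → Fin (suc p) → Fin (suc p) → ℕ
crossings N Λ i j = length (filter (λ e → isCrossingOf i j e ≡? true) (events initial N Λ))
  where
  open import Data.Bool using () renaming (_≟_ to _≡?_)

Supports : ∀ {p} → Network p → Choice → Set
Supports {p} N Λ =
  (length Λ ≡ length N) × (∀ (i j : Fin (suc p)) → i ≢ j → crossings N Λ i j ≡ 1)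

Sorting : ∀ {p} → Network p → Set
Sorting N = Data.Product.∃ (λ Λ → Supports N Λ)
  where import Data.Product

contactArc : ∀ {p} → Event p → List (Fin (suc p) × Fin (suc p))
contactArc (true , u , l) = []
contactArc (false , u , l) = (u , l) ∷ []

contactGraph : ∀ {p} → Network p → Choice → List (Fin (suc p) × Fin (suc p))
contactGraph N Λ = Data.List.concatMap contactArc (events initial N Λ)
  where import Data.List

Adjacent : ∀ {p} → List (Fin (suc p) × Fin (suc p)) → Fin (suc p) → Fin (suc p) → Set
Adjacent G i j = ((i , j) ∈ G) ⊎ ((j , i) ∈ G)

Connected : ∀ {p} → List (Fin (suc p) × Fin (suc p)) → Fin (suc p) → Fin (suc p) → Set
Connected G = Star (Adjacent G)

-- Compare the two arrangements commutator by commutator.  Where they agree, the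
-- claim passes to the rest of the network.  Where one of them crosses the two
-- pseudolines a, b meeting at a commutator and the other only touches them, the
-- latter crosses a and b at some later commutator; moving that crossing forward
-- to the contact gives a third arrangement with the same crossings and the same
-- contact components, which agrees with the first one at this commutator.

module Submission where

open import Defs
open import Data.Bool using (Bool; true; false; _∧_; _∨_; not; if_then_else_; _xor_)
import Data.Bool as Bool
open import Data.Bool.Properties using (∧-comm; ∨-comm; ∨-zeroʳ; xor-assoc; xor-identityʳ; not-injective)
open import Data.Empty using (⊥-elim)
open import Data.Fin using (Fin; suc; toℕ; inject₁; _≟_; _<_)
open import Data.Fin.Properties using (toℕ-injective; toℕ-inject₁; _<?_)
open import Data.List using (List; []; _∷_; _++_; map; length; filter; concatMap)
open import Data.List.Membership.Propositional using (_∈_)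
open import Data.List.Membership.Propositional.Properties using (∈-++⁺ˡ; ∈-++⁺ʳ; ∈-++⁻; ∈-map⁺; ∈-map⁻)
open import Data.List.Properties using (length-++)
open import Data.List.Relation.Unary.Any using (here; there)
open import Data.Nat using (ℕ; zero; suc; _+_; _≤_; z≤n; s≤s)
import Data.Nat as ℕ
open import Data.Nat.Properties
  using (suc-injective; 1+n≢0; n<1+n; <-irrefl; <-asym; ≤∧≢⇒<; m<n⇒m<1+n; m<1+n⇒m≤n; <⇒≤;
         +-assoc; +-cancelˡ-≡; +-commutativeSemigroup; m≤m+n; m≤n+m; ≤-trans)
open import Algebra.Properties.CommutativeSemigroup +-commutativeSemigroup using (x∙yz≈y∙xz)
open import Data.Product using (_×_; _,_; proj₁; proj₂)
import Data.Product
open import Data.Sum using (_⊎_; inj₁; inj₂)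
import Data.Sum
open import Function using (id)
open import Function.Bundles using (_⇔_; mk⇔)
open import Relation.Binary.Construct.Closure.ReflexiveTransitive using (ε; _◅_; _◅◅_; gmap; reverse)
open import Relation.Binary.PropositionalEquality
open import Relation.Nullary using (¬_; yes; no; does)
open import Relation.Nullary.Decidable using (isYes≗does; dec-true; dec-false; does-⇔)
open import Relation.Nullary.Negation using (contradiction)

private variable
  n p : ℕ

==-≡ : {x y : Fin n} → x ≡ y → (x == y) ≡ true
==-≡ {x = x} {y} x≡y = trans (isYes≗does (x ≟ y)) (dec-true (x ≟ y) x≡y)

==-≢ : {x y : Fin n} → x ≢ y → (x == y) ≡ false
==-≢ {x = x} {y} x≢y = trans (isYes≗does (x ≟ y)) (dec-false (x ≟ y) x≢y)

==⇒≡ : {x y : Fin n} → (x == y) ≡ true → x ≡ y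
==⇒≡ {x = x} {y} eq with x ≟ y
... | yes x≡y = x≡y
==⇒≡ () | no _

-- swapAt k is, by definition, transpose (inject₁ k) (suc k).
transpose : Fin n → Fin n → Fin n → Fin n
transpose a b x = if x == a then b else (if x == b then a else x)

data PairView (a b x : Fin n) : Set where
  is-a    : x ≡ a → PairView a b x
  is-b    : x ≡ b → PairView a b x
  neither : x ≢ a → x ≢ b → PairView a b x

pairView : (a b x : Fin n) → PairView a b x
pairView a b x with x ≟ a | x ≟ b
... | yes x≡a | _       = is-a x≡a
... | no _    | yes x≡b = is-b x≡b
... | no x≢a  | no x≢b  = neither x≢a x≢b

transpose-a : (a b : Fin n) → transpose a b a ≡ b
transpose-a a b rewrite ==-≡ (refl {x = a}) = refl

transpose-b : (a b : Fin n) → transpose a b b ≡ a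
transpose-b a b with b ≟ a
... | yes b≡a = b≡a
... | no _ rewrite ==-≡ (refl {x = b}) = refl

transpose-other : {a b x : Fin n} → x ≢ a → x ≢ b → transpose a b x ≡ x
transpose-other x≢a x≢b rewrite ==-≢ x≢a | ==-≢ x≢b = refl

transpose-involutive : (a b x : Fin n) → transpose a b (transpose a b x) ≡ x
transpose-involutive a b x with pairView a b x
... | is-a refl rewrite transpose-a a b = transpose-b a b
... | is-b refl rewrite transpose-b a b = transpose-a a b
... | neither x≢a x≢b rewrite transpose-other x≢a x≢b = transpose-other x≢a x≢b

transpose-comm : (a b x : Fin n) → transpose a b x ≡ transpose b a x
transpose-comm a b x with pairView a b x
... | is-a refl = trans (transpose-a a b) (sym (transpose-b b a))
... | is-b refl = trans (transpose-b a b) (sym (transpose-a b a))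
... | neither x≢a x≢b = trans (transpose-other x≢a x≢b) (sym (transpose-other x≢b x≢a))

transpose-== : (a b x y : Fin n) → (transpose a b x == y) ≡ (x == transpose a b y)
transpose-== a b x y with x ≟ transpose a b y
... | yes refl = ==-≡ (transpose-involutive a b y)
... | no x≢τy  = ==-≢ λ τx≡y → x≢τy (trans (sym (transpose-involutive a b x)) (cong (transpose a b) τx≡y))

swapAt-lower : (k : Fin p) → swapAt k (inject₁ k) ≡ suc k
swapAt-lower k = transpose-a (inject₁ k) (suc k)

swapAt-upper : (k : Fin p) → swapAt k (suc k) ≡ inject₁ k
swapAt-upper k = transpose-b (inject₁ k) (suc k)

swapAt-involutive : (k : Fin p) (l : Fin (suc p)) → swapAt k (swapAt k l) ≡ l
swapAt-involutive k = transpose-involutive (inject₁ k) (suc k)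

inject₁<suc : (k : Fin p) → inject₁ k < suc k
inject₁<suc k = subst (ℕ._< suc (toℕ k)) (sym (toℕ-inject₁ k)) (n<1+n (toℕ k))

suc≢inject₁ : (k : Fin p) → suc k ≢ inject₁ k
suc≢inject₁ k eq = <-irrefl (cong toℕ (sym eq)) (inject₁<suc k)

-- Swapping the contents of levels k and k+1 moves no other level past either of them.
<-suc⇔<-inject₁ : (k : Fin p) {l : Fin (suc p)} → l ≢ inject₁ k → l ≢ suc k →
                  (l < suc k) ⇔ (l < inject₁ k)
<-suc⇔<-inject₁ k {l} l≢k _ = mk⇔
  (λ l<k+1 → subst (toℕ l ℕ.<_) (sym (toℕ-inject₁ k)) (≤∧≢⇒< (m<1+n⇒m≤n l<k+1) l≢k'))
  (λ l<k → m<n⇒m<1+n (subst (toℕ l ℕ.<_) (toℕ-inject₁ k) l<k))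
  where
  l≢k' : toℕ l ≢ toℕ k
  l≢k' eq = l≢k (toℕ-injective (trans eq (sym (toℕ-inject₁ k))))

inject₁-<⇔suc-< : (k : Fin p) {l : Fin (suc p)} → l ≢ inject₁ k → l ≢ suc k →
                  (inject₁ k < l) ⇔ (suc k < l)
inject₁-<⇔suc-< k {l} _ l≢k+1 = mk⇔
  (λ k<l → ≤∧≢⇒< (subst (ℕ._< toℕ l) (toℕ-inject₁ k) k<l) λ eq → l≢k+1 (toℕ-injective (sym eq)))
  (λ k+1<l → subst (ℕ._< toℕ l) (sym (toℕ-inject₁ k)) (<⇒≤ k+1<l))

∧-true : {a b : Bool} → (a ∧ b) ≡ true → a ≡ true × b ≡ true
∧-true {true} {true} _ = refl , refl

∨-true : {a b : Bool} → (a ∨ b) ≡ true → a ≡ true ⊎ b ≡ true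
∨-true {true}  _ = inj₁ refl
∨-true {false} e = inj₂ e

data CrossingShape (x y u l : Fin n) : Set where
  downward : u ≡ x → l ≡ y → CrossingShape x y u l
  upward   : u ≡ y → l ≡ x → CrossingShape x y u l

crossingShape : {x y u l : Fin (suc p)} → isCrossingOf x y (true , u , l) ≡ true → CrossingShape x y u l
crossingShape crossing with ∨-true crossing
... | inj₁ c = downward (==⇒≡ (proj₁ (∧-true c))) (==⇒≡ (proj₂ (∧-true c)))
... | inj₂ c = upward (==⇒≡ (proj₁ (∧-true c))) (==⇒≡ (proj₂ (∧-true c)))

crossing-downward : (x y : Fin (suc p)) → isCrossingOf x y (true , x , y) ≡ true
crossing-downward x y rewrite ==-≡ (refl {x = x}) | ==-≡ (refl {x = y}) = refl

crossing-upward : (x y : Fin (suc p)) → isCrossingOf x y (true , y , x) ≡ true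
crossing-upward x y rewrite ==-≡ (refl {x = x}) | ==-≡ (refl {x = y}) = ∨-zeroʳ _

crossing-swap : (x y u l : Fin (suc p)) → isCrossingOf x y (true , l , u) ≡ isCrossingOf x y (true , u , l)
crossing-swap x y u l rewrite ∧-comm (l == x) (u == y) | ∧-comm (l == y) (u == x) =
  ∨-comm ((u == y) ∧ (l == x)) ((u == x) ∧ (l == y))

-- σ l is the pseudoline on level l; π x is the level of pseudoline x.
record InverseStates (σ π : State p) : Set where
  field
    level-occupant : ∀ l → π (σ l) ≡ l
    occupant-level : ∀ x → σ (π x) ≡ x

  occupant-injective : ∀ {l l'} → σ l ≡ σ l' → l ≡ l'
  occupant-injective {l} {l'} eq = trans (sym (level-occupant l)) (trans (cong π eq) (level-occupant l'))

open InverseStates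

initial-inverse : InverseStates {p} initial initial
initial-inverse = record { level-occupant = λ _ → refl ; occupant-level = λ _ → refl }

stepLevel : State p → Fin p → Bool → State p
stepLevel π k false = π
stepLevel π k true  = λ x → swapAt k (π x)

step-inverse : {σ π : State p} (k : Fin p) (b : Bool) →
               InverseStates σ π → InverseStates (step σ k b) (stepLevel π k b)
step-inverse k false inv = inv
step-inverse {σ = σ} {π} k true inv = record
  { level-occupant = λ l → trans (cong (swapAt k) (level-occupant inv (swapAt k l))) (swapAt-involutive k l)
  ; occupant-level = λ x → trans (cong σ (swapAt-involutive k (π x))) (occupant-level inv x)
  }

run : State p → Network p → Choice → State p
run σ (k ∷ N) (b ∷ Λ) = run (step σ k b) N Λ
run σ _ _ = σ

runLevel : State p → Network p → Choice → State p
runLevel π (k ∷ N) (b ∷ Λ) = runLevel (stepLevel π k b) N Λ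
runLevel π _ _ = π

run-inverse : {σ π : State p} (N : Network p) (Λ : Choice) →
              InverseStates σ π → InverseStates (run σ N Λ) (runLevel π N Λ)
run-inverse []      Λ       inv = inv
run-inverse (k ∷ N) []      inv = inv
run-inverse (k ∷ N) (b ∷ Λ) inv = run-inverse N Λ (step-inverse k b inv)

occupant-swapAt : {σ π : State p} → InverseStates σ π → (k : Fin p) (l : Fin (suc p)) →
                  σ (swapAt k l) ≡ transpose (σ (suc k)) (σ (inject₁ k)) (σ l)
occupant-swapAt {σ = σ} inv k l with pairView (inject₁ k) (suc k) l
... | is-a refl = trans (cong σ (swapAt-lower k)) (sym (transpose-b (σ (suc k)) (σ (inject₁ k))))
... | is-b refl = trans (cong σ (swapAt-upper k)) (sym (transpose-a (σ (suc k)) (σ (inject₁ k))))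
... | neither l≢k l≢k+1 = trans (cong σ (transpose-other l≢k l≢k+1))
        (sym (transpose-other (λ eq → l≢k+1 (occupant-injective inv eq)) (λ eq → l≢k (occupant-injective inv eq))))

above : State p → Fin (suc p) → Fin (suc p) → Bool
above π x y = does (π y <? π x)

swapAt-preserves-order : (k : Fin p) (P Q : Fin (suc p)) → P ≢ Q →
  ¬ (P ≡ suc k × Q ≡ inject₁ k) → ¬ (P ≡ inject₁ k × Q ≡ suc k) →
  does (swapAt k Q <? swapAt k P) ≡ does (Q <? P)
swapAt-preserves-order k P Q P≢Q not-down not-up
  with pairView (inject₁ k) (suc k) P | pairView (inject₁ k) (suc k) Q
... | is-a refl | is-a refl = ⊥-elim (P≢Q refl)
... | is-b refl | is-b refl = ⊥-elim (P≢Q refl)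
... | is-a refl | is-b refl = ⊥-elim (not-up (refl , refl))
... | is-b refl | is-a refl = ⊥-elim (not-down (refl , refl))
... | is-a refl | neither Q≢k Q≢k+1 rewrite swapAt-lower k | transpose-other Q≢k Q≢k+1 =
  does-⇔ (<-suc⇔<-inject₁ k Q≢k Q≢k+1) (Q <? suc k) (Q <? inject₁ k)
... | is-b refl | neither Q≢k Q≢k+1 rewrite swapAt-upper k | transpose-other Q≢k Q≢k+1 =
  sym (does-⇔ (<-suc⇔<-inject₁ k Q≢k Q≢k+1) (Q <? suc k) (Q <? inject₁ k))
... | neither P≢k P≢k+1 | is-a refl rewrite swapAt-lower k | transpose-other P≢k P≢k+1 =
  sym (does-⇔ (inject₁-<⇔suc-< k P≢k P≢k+1) (inject₁ k <? P) (suc k <? P))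
... | neither P≢k P≢k+1 | is-b refl rewrite swapAt-upper k | transpose-other P≢k P≢k+1 =
  does-⇔ (inject₁-<⇔suc-< k P≢k P≢k+1) (inject₁ k <? P) (suc k <? P)
... | neither P≢k P≢k+1 | neither Q≢k Q≢k+1
  rewrite transpose-other P≢k P≢k+1 | transpose-other Q≢k Q≢k+1 = refl

no-crossing-shape : {x y u l : Fin (suc p)} → isCrossingOf x y (true , u , l) ≡ false → ¬ CrossingShape x y u l
no-crossing-shape {x = x} {y} no-crossing (downward refl refl) =
  contradiction (trans (sym (crossing-downward x y)) no-crossing) λ ()
no-crossing-shape {x = x} {y} no-crossing (upward refl refl) =
  contradiction (trans (sym (crossing-upward x y)) no-crossing) λ ()

adjacent-distinct : {σ π : State p} → InverseStates σ π → (k : Fin p) → σ (suc k) ≢ σ (inject₁ k)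
adjacent-distinct inv k eq = suc≢inject₁ k (occupant-injective inv eq)

level-≢ : {σ π : State p} → InverseStates σ π → {x : Fin (suc p)} {l : Fin (suc p)} → x ≢ σ l → π x ≢ l
level-≢ {σ = σ} inv {x} x≢σl πx≡l = x≢σl (trans (sym (occupant-level inv x)) (cong σ πx≡l))

above-step : {σ π : State p} → InverseStates σ π → {x y : Fin (suc p)} → x ≢ y → (k : Fin p) (b : Bool) →
  above (stepLevel π k b) x y ≡ above π x y xor isCrossingOf x y (b , σ (suc k) , σ (inject₁ k))
above-step inv x≢y k false = sym (xor-identityʳ _)
above-step {σ = σ} {π} inv {x} {y} x≢y k true with isCrossingOf x y (true , σ (suc k) , σ (inject₁ k)) in crossing
... | true with crossingShape {x = x} {y} {σ (suc k)} {σ (inject₁ k)} crossing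
...   | downward refl refl
  rewrite level-occupant inv (suc k) | level-occupant inv (inject₁ k) | swapAt-lower k | swapAt-upper k
        | dec-true (inject₁ k <? suc k) (inject₁<suc k) | dec-false (suc k <? inject₁ k) (<-asym (inject₁<suc k)) = refl
...   | upward refl refl
  rewrite level-occupant inv (suc k) | level-occupant inv (inject₁ k) | swapAt-lower k | swapAt-upper k
        | dec-true (inject₁ k <? suc k) (inject₁<suc k) | dec-false (suc k <? inject₁ k) (<-asym (inject₁<suc k)) = refl
above-step {σ = σ} {π} inv {x} {y} x≢y k true | false =
  trans (swapAt-preserves-order k (π x) (π y) πx≢πy not-downward not-upward) (sym (xor-identityʳ _))
  where
  occupant : ∀ {z l} → π z ≡ l → σ l ≡ z
  occupant {z} eq = trans (cong σ (sym eq)) (occupant-level inv z)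
  πx≢πy : π x ≢ π y
  πx≢πy eq = x≢y (trans (sym (occupant eq)) (occupant-level inv y))
  no-shape : ¬ CrossingShape x y (σ (suc k)) (σ (inject₁ k))
  no-shape = no-crossing-shape {x = x} {y} {σ (suc k)} {σ (inject₁ k)} crossing
  not-downward : ¬ (π x ≡ suc k × π y ≡ inject₁ k)
  not-downward (πx≡k+1 , πy≡k) = no-shape (downward (occupant πx≡k+1) (occupant πy≡k))
  not-upward : ¬ (π x ≡ inject₁ k × π y ≡ suc k)
  not-upward (πx≡k , πy≡k+1) = no-shape (upward (occupant πy≡k+1) (occupant πx≡k))

above-adjacent : {σ π : State p} → InverseStates σ π → (k : Fin p) {x : Fin (suc p)} →
  x ≢ σ (suc k) → x ≢ σ (inject₁ k) → above π x (σ (suc k)) ≡ above π x (σ (inject₁ k))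
above-adjacent {σ = σ} {π} inv k {x} x≢k+1 x≢k
  rewrite level-occupant inv (suc k) | level-occupant inv (inject₁ k) =
  sym (does-⇔ (inject₁-<⇔suc-< k (level-≢ inv x≢k) (level-≢ inv x≢k+1)) (inject₁ k <? π x) (suc k <? π x))

fromBool : Bool → ℕ
fromBool false = 0
fromBool true  = 1

crossingCount : List (Event p) → Fin (suc p) → Fin (suc p) → ℕ
crossingCount []      x y = 0
crossingCount (e ∷ E) x y = fromBool (isCrossingOf x y e) + crossingCount E x y

isOdd : ℕ → Bool
isOdd zero    = false
isOdd (suc m) = not (isOdd m)

isOdd-fromBool-+ : (b : Bool) (m : ℕ) → isOdd (fromBool b + m) ≡ b xor isOdd m
isOdd-fromBool-+ false m = refl
isOdd-fromBool-+ true  m = refl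

isOdd-injective-≤1 : {m m' : ℕ} → m ≤ 1 → m' ≤ 1 → isOdd m ≡ isOdd m' → m ≡ m'
isOdd-injective-≤1 {zero}        {zero}        _        _        _  = refl
isOdd-injective-≤1 {suc zero}    {suc zero}    _        _        _  = refl
isOdd-injective-≤1 {zero}        {suc zero}    _        _        ()
isOdd-injective-≤1 {suc zero}    {zero}        _        _        ()
isOdd-injective-≤1 {suc (suc _)} {_}           (s≤s ()) _        _
isOdd-injective-≤1 {_}           {suc (suc _)} _        (s≤s ()) _

xor-cancelˡ : (a : Bool) {b c : Bool} → a xor b ≡ a xor c → b ≡ c
xor-cancelˡ false eq = eq
xor-cancelˡ true  eq = not-injective eq

-- Two pseudolines swap their vertical order exactly at their crossings.
above-run : {σ π : State p} → InverseStates σ π → {x y : Fin (suc p)} → x ≢ y → (N : Network p) (Λ : Choice) →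
  above (runLevel π N Λ) x y ≡ above π x y xor isOdd (crossingCount (events σ N Λ) x y)
above-run inv x≢y []      Λ       = sym (xor-identityʳ _)
above-run inv x≢y (k ∷ N) []      = sym (xor-identityʳ _)
above-run {σ = σ} {π} inv {x} {y} x≢y (k ∷ N) (b ∷ Λ) = begin
  above (runLevel (stepLevel π k b) N Λ) x y
    ≡⟨ above-run (step-inverse k b inv) x≢y N Λ ⟩
  above (stepLevel π k b) x y xor isOdd rest
    ≡⟨ cong (_xor isOdd rest) (above-step inv x≢y k b) ⟩
  (above π x y xor current) xor isOdd rest
    ≡⟨ xor-assoc (above π x y) current (isOdd rest) ⟩
  above π x y xor (current xor isOdd rest)
    ≡⟨ cong (above π x y xor_) (sym (isOdd-fromBool-+ current rest)) ⟩
  above π x y xor isOdd (fromBool current + rest)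
    ∎
  where
  open ≡-Reasoning
  current : Bool
  current = isCrossingOf x y (b , σ (suc k) , σ (inject₁ k))
  rest : ℕ
  rest = crossingCount (events (step σ k b) N Λ) x y

relabel : (Fin (suc p) → Fin (suc p)) → Event p → Event p
relabel f (b , u , l) = (b , f u , f l)

events-relabel : (f : Fin (suc p) → Fin (suc p)) (σ : State p) (N : Network p) (Λ : Choice) →
  events (λ l → f (σ l)) N Λ ≡ map (relabel f) (events σ N Λ)
events-relabel f σ []      Λ            = refl
events-relabel f σ (k ∷ N) []           = refl
events-relabel f σ (k ∷ N) (false ∷ Λ) = cong (_ ∷_) (events-relabel f σ N Λ)
events-relabel f σ (k ∷ N) (true ∷ Λ)  = cong (_ ∷_) (events-relabel f (step σ k true) N Λ)

run-relabel : (f : Fin (suc p) → Fin (suc p)) (σ : State p) (N : Network p) (Λ : Choice) (l : Fin (suc p)) →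
  run (λ l → f (σ l)) N Λ l ≡ f (run σ N Λ l)
run-relabel f σ []      Λ            l = refl
run-relabel f σ (k ∷ N) []           l = refl
run-relabel f σ (k ∷ N) (false ∷ Λ) l = run-relabel f σ N Λ l
run-relabel f σ (k ∷ N) (true ∷ Λ)  l = run-relabel f (step σ k true) N Λ l

events-cong : {σ σ' : State p} → (∀ l → σ l ≡ σ' l) → (N : Network p) (Λ : Choice) →
  events σ N Λ ≡ events σ' N Λ
events-cong σ≗σ' []      Λ       = refl
events-cong σ≗σ' (k ∷ N) []      = refl
events-cong {σ = σ} {σ'} σ≗σ' (k ∷ N) (b ∷ Λ) =
  cong₂ _∷_ (cong₂ (λ u l → (b , u , l)) (σ≗σ' (suc k)) (σ≗σ' (inject₁ k))) (events-cong (step-cong b) N Λ)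
  where
  step-cong : ∀ c l → step σ k c l ≡ step σ' k c l
  step-cong false l = σ≗σ' l
  step-cong true  l = σ≗σ' (swapAt k l)

events-++ : (σ : State p) (N₁ N₂ : Network p) (L₁ L₂ : Choice) → length N₁ ≡ length L₁ →
  events σ (N₁ ++ N₂) (L₁ ++ L₂) ≡ events σ N₁ L₁ ++ events (run σ N₁ L₁) N₂ L₂
events-++ σ []       N₂ []       L₂ _   = refl
events-++ σ (k ∷ N₁) N₂ (b ∷ L₁) L₂ len = cong (_ ∷_) (events-++ (step σ k b) N₁ N₂ L₁ L₂ (suc-injective len))

crossings≡crossingCount : (N : Network p) (Λ : Choice) (x y : Fin (suc p)) →
  crossings N Λ x y ≡ crossingCount (events initial N Λ) x y
crossings≡crossingCount N Λ x y = count-filter (events initial N Λ)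
  where
  count-filter : ∀ E → length (filter (λ e → isCrossingOf x y e Bool.≟ true) E) ≡ crossingCount E x y
  count-filter [] = refl
  count-filter (e ∷ E) with isCrossingOf x y e
  ... | true  = cong suc (count-filter E)
  ... | false = count-filter E

crossingCount-++ : (E F : List (Event p)) (x y : Fin (suc p)) →
  crossingCount (E ++ F) x y ≡ crossingCount E x y + crossingCount F x y
crossingCount-++ []      F x y = refl
crossingCount-++ (e ∷ E) F x y =
  trans (cong (fromBool (isCrossingOf x y e) +_) (crossingCount-++ E F x y))
        (sym (+-assoc (fromBool (isCrossingOf x y e)) (crossingCount E x y) (crossingCount F x y)))

crossingCount-sym : (E : List (Event p)) (x y : Fin (suc p)) → crossingCount E x y ≡ crossingCount E y x
crossingCount-sym []                x y = refl
crossingCount-sym ((b , u , l) ∷ E) x y =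
  cong₂ _+_ (cong (λ c → fromBool (b ∧ c)) (∨-comm ((u == x) ∧ (l == y)) ((u == y) ∧ (l == x))))
            (crossingCount-sym E x y)

crossingCount-transpose : (a b : Fin (suc p)) (E : List (Event p)) (x y : Fin (suc p)) →
  crossingCount (map (relabel (transpose a b)) E) x y ≡ crossingCount E (transpose a b x) (transpose a b y)
crossingCount-transpose a b []                 x y = refl
crossingCount-transpose a b ((c , u , l) ∷ E) x y
  rewrite transpose-== a b u x | transpose-== a b l y | transpose-== a b u y | transpose-== a b l x =
  cong (_ +_) (crossingCount-transpose a b E x y)

record SameCrossings (E F : List (Event p)) : Set where
  constructor same-crossings
  field
    crossingCount-≡ : ∀ x y → x ≢ y → crossingCount E x y ≡ crossingCount F x y

record CrossAtMostOnce (E : List (Event p)) : Set where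
  constructor cross-at-most-once
  field
    crossingCount-≤1 : ∀ x y → x ≢ y → crossingCount E x y ≤ 1

open SameCrossings
open CrossAtMostOnce

SameCrossings-sym : {E F : List (Event p)} → SameCrossings E F → SameCrossings F E
SameCrossings-sym same = same-crossings λ x y x≢y → sym (crossingCount-≡ same x y x≢y)

SameCrossings-trans : {E F G : List (Event p)} → SameCrossings E F → SameCrossings F G → SameCrossings E G
SameCrossings-trans same same' = same-crossings λ x y x≢y →
  trans (crossingCount-≡ same x y x≢y) (crossingCount-≡ same' x y x≢y)

SameCrossings-tail : {e : Event p} {E F : List (Event p)} → SameCrossings (e ∷ E) (e ∷ F) → SameCrossings E F
SameCrossings-tail {e = e} same = same-crossings λ x y x≢y →
  +-cancelˡ-≡ (fromBool (isCrossingOf x y e)) _ _ (crossingCount-≡ same x y x≢y)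

CrossAtMostOnce-tail : {e : Event p} {E : List (Event p)} → CrossAtMostOnce (e ∷ E) → CrossAtMostOnce E
CrossAtMostOnce-tail once = cross-at-most-once λ x y x≢y → ≤-trans (m≤n+m _ _) (crossingCount-≤1 once x y x≢y)

CrossAtMostOnce-transport : {E F : List (Event p)} → SameCrossings E F → CrossAtMostOnce F → CrossAtMostOnce E
CrossAtMostOnce-transport same once = cross-at-most-once λ x y x≢y →
  subst (_≤ 1) (sym (crossingCount-≡ same x y x≢y)) (crossingCount-≤1 once x y x≢y)

contacts : List (Event p) → List (Fin (suc p) × Fin (suc p))
contacts = concatMap contactArc

ConnectedIn : List (Event p) → Fin (suc p) → Fin (suc p) → Set
ConnectedIn E = Connected (contacts E)

contact⇒arc : (E : List (Event p)) {u v : Fin (suc p)} → (false , u , v) ∈ E → (u , v) ∈ contacts E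
contact⇒arc ((true  , _ , _) ∷ E) (there m)   = contact⇒arc E m
contact⇒arc ((false , _ , _) ∷ E) (here refl) = here refl
contact⇒arc ((false , _ , _) ∷ E) (there m)   = there (contact⇒arc E m)

arc⇒contact : (E : List (Event p)) {u v : Fin (suc p)} → (u , v) ∈ contacts E → (false , u , v) ∈ E
arc⇒contact ((true  , _ , _) ∷ E) m           = there (arc⇒contact E m)
arc⇒contact ((false , _ , _) ∷ E) (here refl) = here refl
arc⇒contact ((false , _ , _) ∷ E) (there m)   = there (arc⇒contact E m)

contact-connected : (E : List (Event p)) {u v : Fin (suc p)} → (false , u , v) ∈ E → ConnectedIn E u v
contact-connected E m = inj₁ (contact⇒arc E m) ◅ ε

connected-sym : {G : List (Fin (suc p) × Fin (suc p))} {u v : Fin (suc p)} → Connected G u v → Connected G v u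
connected-sym {G = G} = reverse {T = Adjacent G} Data.Sum.swap

connected-⊆ : {G H : List (Fin (suc p) × Fin (suc p))} → (∀ {e} → e ∈ G → e ∈ H) →
  {u v : Fin (suc p)} → Connected G u v → Connected H u v
connected-⊆ G⊆H = gmap id (Data.Sum.map G⊆H G⊆H)

connected-transpose : {G : List (Fin (suc p) × Fin (suc p))} {a b : Fin (suc p)} (x : Fin (suc p)) →
  Connected G a b → Connected G x (transpose a b x)
connected-transpose {a = a} {b} x a~b with pairView a b x
... | is-a refl rewrite transpose-a a b = a~b
... | is-b refl rewrite transpose-b a b = connected-sym a~b
... | neither x≢a x≢b rewrite transpose-other x≢a x≢b = ε

-- E ⊑ F: the endpoints of every contact of E are connected in the contact graph of F,
-- so every connected component of E lies inside one of F.
record _⊑_ (E F : List (Event p)) : Set where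
  constructor joins
  field
    joined : ∀ {u v} → (false , u , v) ∈ E → ConnectedIn F u v

open _⊑_

⊑-connected : {E F : List (Event p)} {x y : Fin (suc p)} → E ⊑ F → ConnectedIn E x y → ConnectedIn F x y
⊑-connected E⊑F ε = ε
⊑-connected {E = E} E⊑F (inj₁ m ◅ rest) = joined E⊑F (arc⇒contact E m) ◅◅ ⊑-connected E⊑F rest
⊑-connected {E = E} E⊑F (inj₂ m ◅ rest) = connected-sym (joined E⊑F (arc⇒contact E m)) ◅◅ ⊑-connected E⊑F rest

⊑-trans : {E F G : List (Event p)} → E ⊑ F → F ⊑ G → E ⊑ G
⊑-trans E⊑F F⊑G = joins λ m → ⊑-connected F⊑G (joined E⊑F m)

⊑-cons : {e : Event p} {E F : List (Event p)} → E ⊑ F → (e ∷ E) ⊑ (e ∷ F)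
⊑-cons {e = e} {F = F} E⊑F = joins λ
  { (here refl) → contact-connected (e ∷ F) (here refl)
  ; (there m)   → connected-⊆ (∈-++⁺ʳ (contactArc e)) (joined E⊑F m)
  }

SameComponents : List (Event p) → List (Event p) → Set
SameComponents E F = E ⊑ F × F ⊑ E

SameComponents-trans : {E F G : List (Event p)} → SameComponents E F → SameComponents F G → SameComponents E G
SameComponents-trans (E⊑F , F⊑E) (F⊑G , G⊑F) = ⊑-trans E⊑F F⊑G , ⊑-trans G⊑F F⊑E

SameComponents-cons : {e : Event p} {E F : List (Event p)} → SameComponents E F → SameComponents (e ∷ E) (e ∷ F)
SameComponents-cons (E⊑F , F⊑E) = ⊑-cons E⊑F , ⊑-cons F⊑E

-- Moving a crossing forward

record SplitAtCrossing (σ : State p) (a b : Fin (suc p)) (N : Network p) (Λ : Choice) : Set where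
  field
    N₁ : Network p
    k' : Fin p
    N₂ : Network p
    L₁ L₂ : Choice
    network-split : N ≡ N₁ ++ k' ∷ N₂
    choice-split : Λ ≡ L₁ ++ true ∷ L₂
    aligned : length N₁ ≡ length L₁
    crossing : isCrossingOf a b (true , run σ N₁ L₁ (suc k') , run σ N₁ L₁ (inject₁ k')) ≡ true

split-cons : {σ : State p} {a b : Fin (suc p)} {N : Network p} {Λ : Choice} (k : Fin p) (c : Bool) →
  SplitAtCrossing (step σ k c) a b N Λ → SplitAtCrossing σ a b (k ∷ N) (c ∷ Λ)
split-cons k c s = record
  { N₁ = k ∷ N₁ ; k' = k' ; N₂ = N₂ ; L₁ = c ∷ L₁ ; L₂ = L₂
  ; network-split = cong (k ∷_) network-split ; choice-split = cong (c ∷_) choice-split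
  ; aligned = cong suc aligned ; crossing = crossing }
  where open SplitAtCrossing s

splitAtCrossing : (σ : State p) (a b : Fin (suc p)) (N : Network p) (Λ : Choice) →
  crossingCount (events σ N Λ) a b ≢ 0 → SplitAtCrossing σ a b N Λ
splitAtCrossing σ a b []      Λ           none = ⊥-elim (none refl)
splitAtCrossing σ a b (k ∷ N) []          none = ⊥-elim (none refl)
splitAtCrossing σ a b (k ∷ N) (false ∷ Λ) some = split-cons k false (splitAtCrossing σ a b N Λ some)
splitAtCrossing σ a b (k ∷ N) (true ∷ Λ)  some with isCrossingOf a b (true , σ (suc k) , σ (inject₁ k)) in crossing
... | true  = record
  { N₁ = [] ; k' = k ; N₂ = N ; L₁ = [] ; L₂ = Λ
  ; network-split = refl ; choice-split = refl ; aligned = refl ; crossing = crossing }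
... | false = split-cons k true (splitAtCrossing (step σ k true) a b N Λ some)

-- Moving the crossing of a and b from commutator k' back to commutator k, where they are
-- in contact, exchanges a and b on the stretch S in between.  As a and b are adjacent at
-- both ends of S, any other pseudoline crosses a in S as often as b modulo 2 (the parity
-- is read off the vertical order), hence equally often, both counts being at most one.
-- So relabelling S by the transposition (a b) keeps all crossing numbers, and it keeps
-- the components because a and b stay in contact (at k', resp. at k).
module MoveCrossingForward {p : ℕ} {σ π : State p} (inv : InverseStates σ π) (k : Fin p)
  (N₁ : Network p) (k' : Fin p) (N₂ : Network p) (L₁ L₂ : Choice) (aligned : length N₁ ≡ length L₁)
  (crossing : isCrossingOf (σ (suc k)) (σ (inject₁ k)) (true , run σ N₁ L₁ (suc k') , run σ N₁ L₁ (inject₁ k')) ≡ true)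
  (once : CrossAtMostOnce (events σ (k ∷ N₁ ++ k' ∷ N₂) (false ∷ L₁ ++ true ∷ L₂)))
  where

  a b : Fin (suc p)
  a = σ (suc k)
  b = σ (inject₁ k)

  τ : Fin (suc p) → Fin (suc p)
  τ = transpose a b

  σ₁ : State p
  σ₁ = run σ N₁ L₁

  π₁ : State p
  π₁ = runLevel π N₁ L₁

  inv₁ : InverseStates σ₁ π₁
  inv₁ = run-inverse N₁ L₁ inv

  u l : Fin (suc p)
  u = σ₁ (suc k')
  l = σ₁ (inject₁ k')

  S R : List (Event p)
  S = events σ N₁ L₁
  R = events (step σ₁ k' true) N₂ L₂

  contactFirst crossingFirst : List (Event p)
  contactFirst  = events σ (k ∷ N₁ ++ k' ∷ N₂) (false ∷ L₁ ++ true ∷ L₂)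
  crossingFirst = events σ (k ∷ N₁ ++ k' ∷ N₂) (true ∷ L₁ ++ false ∷ L₂)

  shape : CrossingShape a b u l
  shape = crossingShape crossing

  contactFirst-≡ : contactFirst ≡ (false , a , b) ∷ S ++ (true , u , l) ∷ R
  contactFirst-≡ = cong (_ ∷_) (events-++ σ N₁ (k' ∷ N₂) L₁ (true ∷ L₂) aligned)

  τ∘σ₁≗σ₁∘swapAt : ∀ z → τ (σ₁ z) ≡ σ₁ (swapAt k' z)
  τ∘σ₁≗σ₁∘swapAt z with shape
  ... | downward u≡a l≡b =
    trans (cong₂ (λ x y → transpose x y (σ₁ z)) (sym u≡a) (sym l≡b)) (sym (occupant-swapAt inv₁ k' z))
  ... | upward u≡b l≡a = trans (transpose-comm a b (σ₁ z))
    (trans (cong₂ (λ x y → transpose x y (σ₁ z)) (sym u≡b) (sym l≡a)) (sym (occupant-swapAt inv₁ k' z)))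

  crossingFirst-≡ : crossingFirst ≡ (true , a , b) ∷ map (relabel τ) S ++ (false , τ u , τ l) ∷ R
  crossingFirst-≡ = cong (_ ∷_) (begin
    events (step σ k true) (N₁ ++ k' ∷ N₂) (L₁ ++ false ∷ L₂)
      ≡⟨ events-cong (occupant-swapAt inv k) (N₁ ++ k' ∷ N₂) (L₁ ++ false ∷ L₂) ⟩
    events (λ z → τ (σ z)) (N₁ ++ k' ∷ N₂) (L₁ ++ false ∷ L₂)
      ≡⟨ events-++ (λ z → τ (σ z)) N₁ (k' ∷ N₂) L₁ (false ∷ L₂) aligned ⟩
    events (λ z → τ (σ z)) N₁ L₁ ++ events (run (λ z → τ (σ z)) N₁ L₁) (k' ∷ N₂) (false ∷ L₂)
      ≡⟨ cong₂ _++_ (events-relabel τ σ N₁ L₁) (events-cong (run-relabel τ σ N₁ L₁) (k' ∷ N₂) (false ∷ L₂)) ⟩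
    map (relabel τ) S ++ (false , τ u , τ l) ∷ events (λ z → τ (σ₁ z)) N₂ L₂
      ≡⟨ cong (λ E → map (relabel τ) S ++ (false , τ u , τ l) ∷ E) (events-cong τ∘σ₁≗σ₁∘swapAt N₂ L₂) ⟩
    map (relabel τ) S ++ (false , τ u , τ l) ∷ R
      ∎)
    where open ≡-Reasoning

  S-once : CrossAtMostOnce S
  S-once = cross-at-most-once λ x y x≢y → ≤-trans (m≤m+n (crossingCount S x y) _)
    (subst (_≤ 1) (crossingCount-++ S ((true , u , l) ∷ R) x y)
      (subst (λ E → crossingCount E x y ≤ 1) contactFirst-≡ (crossingCount-≤1 once x y x≢y)))

  above-a≡above-b-after : ∀ {x} → x ≢ a → x ≢ b → above π₁ x a ≡ above π₁ x b
  above-a≡above-b-after {x} x≢a x≢b with shape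
  ... | downward u≡a l≡b = subst₂ (λ y z → above π₁ x y ≡ above π₁ x z) u≡a l≡b
    (above-adjacent inv₁ k' (λ eq → x≢a (trans eq u≡a)) (λ eq → x≢b (trans eq l≡b)))
  ... | upward u≡b l≡a = sym (subst₂ (λ y z → above π₁ x y ≡ above π₁ x z) u≡b l≡a
    (above-adjacent inv₁ k' (λ eq → x≢b (trans eq u≡b)) (λ eq → x≢a (trans eq l≡a))))

  crossingCount-a≡b : ∀ {x} → x ≢ a → x ≢ b → crossingCount S x a ≡ crossingCount S x b
  crossingCount-a≡b {x} x≢a x≢b =
    isOdd-injective-≤1 (crossingCount-≤1 S-once x a x≢a) (crossingCount-≤1 S-once x b x≢b)
      (xor-cancelˡ (above π x a) (begin
        above π x a xor isOdd (crossingCount S x a)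
          ≡⟨ sym (above-run inv x≢a N₁ L₁) ⟩
        above π₁ x a
          ≡⟨ above-a≡above-b-after x≢a x≢b ⟩
        above π₁ x b
          ≡⟨ above-run inv x≢b N₁ L₁ ⟩
        above π x b xor isOdd (crossingCount S x b)
          ≡⟨ cong (_xor isOdd (crossingCount S x b)) (sym (above-adjacent inv k x≢a x≢b)) ⟩
        above π x a xor isOdd (crossingCount S x b)
          ∎))
    where open ≡-Reasoning

  crossingCount-τ : ∀ x y → x ≢ y → crossingCount S (τ x) (τ y) ≡ crossingCount S x y
  crossingCount-τ x y x≢y with pairView a b x | pairView a b y
  ... | is-a refl | is-a refl = ⊥-elim (x≢y refl)
  ... | is-b refl | is-b refl = ⊥-elim (x≢y refl)
  ... | is-a refl | is-b refl rewrite transpose-a a b | transpose-b a b = crossingCount-sym S b a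
  ... | is-b refl | is-a refl rewrite transpose-a a b | transpose-b a b = crossingCount-sym S a b
  ... | is-a refl | neither y≢a y≢b rewrite transpose-a a b | transpose-other y≢a y≢b =
    trans (crossingCount-sym S b y) (trans (sym (crossingCount-a≡b y≢a y≢b)) (crossingCount-sym S y a))
  ... | is-b refl | neither y≢a y≢b rewrite transpose-b a b | transpose-other y≢a y≢b =
    trans (crossingCount-sym S a y) (trans (crossingCount-a≡b y≢a y≢b) (crossingCount-sym S y b))
  ... | neither x≢a x≢b | is-a refl rewrite transpose-a a b | transpose-other x≢a x≢b = sym (crossingCount-a≡b x≢a x≢b)
  ... | neither x≢a x≢b | is-b refl rewrite transpose-b a b | transpose-other x≢a x≢b = crossingCount-a≡b x≢a x≢b
  ... | neither x≢a x≢b | neither y≢a y≢b rewrite transpose-other x≢a x≢b | transpose-other y≢a y≢b = refl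

  isCrossingOf-ab≡ul : ∀ x y → isCrossingOf x y (true , a , b) ≡ isCrossingOf x y (true , u , l)
  isCrossingOf-ab≡ul x y with shape
  ... | downward u≡a l≡b = cong₂ (λ v w → isCrossingOf x y (true , v , w)) (sym u≡a) (sym l≡b)
  ... | upward u≡b l≡a =
    trans (cong₂ (λ v w → isCrossingOf x y (true , v , w)) (sym l≡a) (sym u≡b)) (crossing-swap x y u l)

  sameCrossings : SameCrossings crossingFirst contactFirst
  sameCrossings = same-crossings counts
    where
    counts : ∀ x y → x ≢ y → crossingCount crossingFirst x y ≡ crossingCount contactFirst x y
    counts x y x≢y = begin
      crossingCount crossingFirst x y
        ≡⟨ cong (λ E → crossingCount E x y) crossingFirst-≡ ⟩
      ab + crossingCount (map (relabel τ) S ++ (false , τ u , τ l) ∷ R) x y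
        ≡⟨ cong (ab +_) (crossingCount-++ (map (relabel τ) S) _ x y) ⟩
      ab + (crossingCount (map (relabel τ) S) x y + crossingCount R x y)
        ≡⟨ cong (λ s → ab + (s + crossingCount R x y)) (trans (crossingCount-transpose a b S x y) (crossingCount-τ x y x≢y)) ⟩
      ab + (crossingCount S x y + crossingCount R x y)
        ≡⟨ x∙yz≈y∙xz ab (crossingCount S x y) (crossingCount R x y) ⟩
      crossingCount S x y + (ab + crossingCount R x y)
        ≡⟨ cong (λ c → crossingCount S x y + (fromBool c + crossingCount R x y)) (isCrossingOf-ab≡ul x y) ⟩
      crossingCount S x y + crossingCount ((true , u , l) ∷ R) x y
        ≡⟨ sym (crossingCount-++ S _ x y) ⟩
      crossingCount (S ++ (true , u , l) ∷ R) x y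
        ≡⟨ cong (λ E → crossingCount E x y) (sym contactFirst-≡) ⟩
      crossingCount contactFirst x y
        ∎
      where
      open ≡-Reasoning
      ab : ℕ
      ab = fromBool (isCrossingOf x y (true , a , b))

  τ-ends : (τ u ≡ b × τ l ≡ a) ⊎ (τ u ≡ a × τ l ≡ b)
  τ-ends with shape
  ... | downward u≡a l≡b = inj₁ (trans (cong τ u≡a) (transpose-a a b) , trans (cong τ l≡b) (transpose-b a b))
  ... | upward u≡b l≡a = inj₂ (trans (cong τ u≡b) (transpose-b a b) , trans (cong τ l≡a) (transpose-a a b))

  τu~τl⇒a~b : {G : List (Fin (suc p) × Fin (suc p))} → Connected G (τ u) (τ l) → Connected G a b
  τu~τl⇒a~b {G} c with τ-ends
  ... | inj₁ (τu≡b , τl≡a) = connected-sym (subst₂ (Connected G) τu≡b τl≡a c)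
  ... | inj₂ (τu≡a , τl≡b) = subst₂ (Connected G) τu≡a τl≡b c

  a~b⇒τu~τl : {G : List (Fin (suc p) × Fin (suc p))} → Connected G a b → Connected G (τ u) (τ l)
  a~b⇒τu~τl {G} c with τ-ends
  ... | inj₁ (τu≡b , τl≡a) = subst₂ (Connected G) (sym τu≡b) (sym τl≡a) (connected-sym c)
  ... | inj₂ (τu≡a , τl≡b) = subst₂ (Connected G) (sym τu≡a) (sym τl≡b) c

  contactFirst⊑crossingFirst : contactFirst ⊑ crossingFirst
  contactFirst⊑crossingFirst = subst₂ _⊑_ (sym contactFirst-≡) (sym crossingFirst-≡) (joins joined₂₃)
    where
    E₃ : List (Event p)
    E₃ = (true , a , b) ∷ map (relabel τ) S ++ (false , τ u , τ l) ∷ R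
    a~b : ConnectedIn E₃ a b
    a~b = τu~τl⇒a~b (contact-connected E₃ (there (∈-++⁺ʳ (map (relabel τ) S) (here refl))))
    joined₂₃ : ∀ {x y} → (false , x , y) ∈ (false , a , b) ∷ S ++ (true , u , l) ∷ R → ConnectedIn E₃ x y
    joined₂₃ (here refl) = a~b
    joined₂₃ {x} {y} (there m) with ∈-++⁻ S m
    ... | inj₁ x-y∈S = connected-transpose x a~b
                   ◅◅ contact-connected E₃ (there (∈-++⁺ˡ (∈-map⁺ (relabel τ) x-y∈S)))
                   ◅◅ connected-sym (connected-transpose y a~b)
    ... | inj₂ (there x-y∈R) = contact-connected E₃ (there (∈-++⁺ʳ (map (relabel τ) S) (there x-y∈R)))

  crossingFirst⊑contactFirst : crossingFirst ⊑ contactFirst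
  crossingFirst⊑contactFirst = subst₂ _⊑_ (sym crossingFirst-≡) (sym contactFirst-≡) (joins joined₃₂)
    where
    E₂ : List (Event p)
    E₂ = (false , a , b) ∷ S ++ (true , u , l) ∷ R
    a~b : ConnectedIn E₂ a b
    a~b = contact-connected E₂ (here refl)
    joined₃₂ : ∀ {x y} → (false , x , y) ∈ (true , a , b) ∷ map (relabel τ) S ++ (false , τ u , τ l) ∷ R → ConnectedIn E₂ x y
    joined₃₂ (there m) with ∈-++⁻ (map (relabel τ) S) m
    ... | inj₁ τx-τy∈τS with ∈-map⁻ (relabel τ) τx-τy∈τS
    ...   | (false , x , y) , x-y∈S , refl = connected-sym (connected-transpose x a~b)
                                        ◅◅ contact-connected E₂ (there (∈-++⁺ˡ x-y∈S))
                                        ◅◅ connected-transpose y a~b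
    joined₃₂ (there m) | inj₂ (here refl) = a~b⇒τu~τl a~b
    joined₃₂ (there m) | inj₂ (there x-y∈R) = contact-connected E₂ (there (∈-++⁺ʳ S (there x-y∈R)))

mutual
  sameComponents : (N : Network p) {σ π : State p} → InverseStates σ π → (Λ₁ Λ₂ : Choice) →
    length Λ₁ ≡ length N → length Λ₂ ≡ length N →
    SameCrossings (events σ N Λ₁) (events σ N Λ₂) → CrossAtMostOnce (events σ N Λ₂) →
    SameComponents (events σ N Λ₁) (events σ N Λ₂)
  sameComponents []      inv Λ₁ Λ₂ _ _ _ _ = joins (λ ()) , joins (λ ())
  sameComponents (k ∷ N) inv []      Λ₂ () _ _ _
  sameComponents (k ∷ N) inv (_ ∷ _) [] _ () _ _
  sameComponents (k ∷ N) inv (false ∷ Λ₁) (false ∷ Λ₂) len₁ len₂ same once =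
    SameComponents-cons (sameComponents N inv Λ₁ Λ₂ (suc-injective len₁) (suc-injective len₂)
                                        (SameCrossings-tail same) (CrossAtMostOnce-tail once))
  sameComponents (k ∷ N) inv (true ∷ Λ₁) (true ∷ Λ₂) len₁ len₂ same once =
    SameComponents-cons (sameComponents N (step-inverse k true inv) Λ₁ Λ₂ (suc-injective len₁) (suc-injective len₂)
                                        (SameCrossings-tail same) (CrossAtMostOnce-tail once))
  sameComponents (k ∷ N) inv (true ∷ Λ₁) (false ∷ Λ₂) len₁ len₂ same once =
    sameComponents-crossing-contact k N inv Λ₁ Λ₂ (suc-injective len₁) (suc-injective len₂) same once
  sameComponents (k ∷ N) inv (false ∷ Λ₁) (true ∷ Λ₂) len₁ len₂ same once =
    Data.Product.swap (sameComponents-crossing-contact k N inv Λ₂ Λ₁ (suc-injective len₂) (suc-injective len₁)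
                                            (SameCrossings-sym same) (CrossAtMostOnce-transport same once))

  sameComponents-crossing-contact : (k : Fin p) (N : Network p) {σ π : State p} → InverseStates σ π → (Λ₁ Λ₂ : Choice) →
    length Λ₁ ≡ length N → length Λ₂ ≡ length N →
    SameCrossings (events σ (k ∷ N) (true ∷ Λ₁)) (events σ (k ∷ N) (false ∷ Λ₂)) →
    CrossAtMostOnce (events σ (k ∷ N) (false ∷ Λ₂)) →
    SameComponents (events σ (k ∷ N) (true ∷ Λ₁)) (events σ (k ∷ N) (false ∷ Λ₂))
  sameComponents-crossing-contact {p} k N {σ} inv Λ₁ Λ₂ len₁ len₂ same once
    with splitAtCrossing σ (σ (suc k)) (σ (inject₁ k)) N Λ₂ crosses-later
    where
    crosses-later : crossingCount (events σ N Λ₂) (σ (suc k)) (σ (inject₁ k)) ≢ 0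
    crosses-later none = 1+n≢0 (begin
      suc (crossingCount (events (step σ k true) N Λ₁) a b)
        ≡⟨ cong (λ c → fromBool c + crossingCount (events (step σ k true) N Λ₁) a b) (sym (crossing-downward a b)) ⟩
      crossingCount (events σ (k ∷ N) (true ∷ Λ₁)) a b
        ≡⟨ crossingCount-≡ same a b (adjacent-distinct inv k) ⟩
      crossingCount (events σ N Λ₂) a b
        ≡⟨ none ⟩
      0 ∎)
      where
      open ≡-Reasoning
      a b : Fin (suc p)
      a = σ (suc k)
      b = σ (inject₁ k)
  ... | record { N₁ = N₁ ; k' = k' ; N₂ = N₂ ; L₁ = L₁ ; L₂ = L₂ ; network-split = refl ; choice-split = refl
               ; aligned = aligned ; crossing = crossing } =
    SameComponents-trans
      (SameComponents-cons (sameComponents (N₁ ++ k' ∷ N₂) (step-inverse k true inv) Λ₁ (L₁ ++ false ∷ L₂)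
        len₁ (trans (length-++ L₁) (trans (sym (length-++ L₁)) len₂))
        (SameCrossings-tail (SameCrossings-trans same (SameCrossings-sym M.sameCrossings)))
        (CrossAtMostOnce-tail (CrossAtMostOnce-transport M.sameCrossings once))))
      (M.crossingFirst⊑contactFirst , M.contactFirst⊑crossingFirst)
    where module M = MoveCrossingForward inv k N₁ k' N₂ L₁ L₂ aligned crossing once

lemma3p6 : (p : ℕ) (N : Network p) → Sorting N → (Λ₁ Λ₂ : Choice) → Supports N Λ₁ → Supports N Λ₂ → (i j : Fin (suc p)) → (Connected (contactGraph N Λ₁) i j → Connected (contactGraph N Λ₂) i j) × (Connected (contactGraph N Λ₂) i j → Connected (contactGraph N Λ₁) i j)
lemma3p6 p N _ Λ₁ Λ₂ (len₁ , one₁) (len₂ , one₂) i j =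
  Data.Product.map ⊑-connected ⊑-connected
    (sameComponents N initial-inverse Λ₁ Λ₂ len₁ len₂ same-counts at-most-once)
  where
  count-is-one : ∀ Λ → (∀ x y → x ≢ y → crossings N Λ x y ≡ 1) →
                 ∀ x y → x ≢ y → crossingCount (events initial N Λ) x y ≡ 1
  count-is-one Λ one x y x≢y = trans (sym (crossings≡crossingCount N Λ x y)) (one x y x≢y)

  same-counts : SameCrossings (events initial N Λ₁) (events initial N Λ₂)
  same-counts = same-crossings λ x y x≢y →
    trans (count-is-one Λ₁ one₁ x y x≢y) (sym (count-is-one Λ₂ one₂ x y x≢y))

  at-most-once : CrossAtMostOnce (events initial N Λ₂)
  at-most-once = cross-at-most-once λ x y x≢y →
    subst (_≤ 1) (sym (count-is-one Λ₂ one₂ x y x≢y)) (s≤s z≤n)
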